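{- For every graph $\langle G,X\rangle$ with $X$ a finite nonempty set of $\mathbf{S}$-variables, and every $[t],[t']\in T\langle G,X\rangle$, if the sets $\Lambda,\Lambda'$ with $L(K[t])=[\Lambda,X]$ and $L(K[t'])=[\Lambda',X]$ are not disjoint, then $[t]=[t']$.
   Context: Relations: $\langle R,X\rangle$ with $R\subseteq X^2$; for $X\cap Y=\emptyset$, $\langle R,X\rangle+\langle S,Y\rangle=\langle R\cup S,X\cup Y\rangle$ and $\langle R,X\rangle\cdot\langle S,Y\rangle=\langle R\cup S\cup(X\times Y),X\cup Y\rangle$. $\langle R,X\rangle$ is connected if for any distinct $x,y\in X$ there is a sequence $x=x_1,\dots,x_n=y$ with $(x_i,x_{i+1})\in R$ or $(x_{i+1},x_i)\in R$ for each $i$. For $y\in X$, $R-y=\{(u,v)\in R\mid u\ne y,v\ne y\}$. $\mathbf{S}$-terms are built from an infinite set of $\mathbf{S}$-variables with binary $+$ and $\cdot$; $[t]$ is the class of $t$ modulo the least congruence making $+$ associative and commutative and $\cdot$ associative. $t$ is diversified if no variable occurs twice. For diversified $t$: $K[x]=\langle\emptyset,\{x\}\rangle$, $K[t+s]=K[t]+K[s]$, $K[t\cdot s]=K[t]\cdot K[s]$. Let $C$ be the least set of classes with $[x]\in C$ for each variable $x$, $[t+s]\in C$ whenever $[t],[s]\in C$, and $[x\cdot t]\in C$ whenever $[t]\in C$ and $x$ is a variable; an $\mathbf{S}$-forest is a diversified element of $C$. A graph is a symmetric irreflexive relation $\langle G,X\rangle$ with $X$ finite nonempty. $T\langle G,X\rangle$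 is defined inductively: if $X=\{x\}$, $T\langle G,X\rangle=\{[x]\}$; if $|X|\ge2$ and $\langle G,X\rangle$ is connected, $T\langle G,X\rangle=\{[x\cdot t]\mid x\in X,\ [t]\in T\langle G-x,X-\{x\}\rangle\}$; if $|X|\ge2$ and $\langle G,X\rangle$ is not connected and equals $\langle G_1,X_1\rangle+\langle G_2,X_2\rangle$ with $X_1,X_2$ nonempty, $T\langle G,X\rangle=\{[t_1+t_2]\mid [t_i]\in T\langle G_i,X_i\rangle\}$. Partial orders are strict; linear orders are partial orders with all distinct elements comparable. For a partial order, $L\langle R,X\rangle=[\{R'\subseteq X^2\mid R\subseteq R',\ \langle R',X\rangle\text{ a linear order}\},X]$. -}

module Defs where

open import Data.Nat using (ℕ)
open import Data.List using (List)
open import Data.List.Membership.Propositional using (_∈_)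
open import Data.Product using (Σ; ∃; _×_; _,_)
open import Data.Sum using (_⊎_)
open import Data.Empty using (⊥)
open import Relation.Nullary using (¬_)
open import Relation.Binary.PropositionalEquality using (_≡_; _≢_)

-- S-variables: the natural numbers (an infinite set).
Var : Set
Var = ℕ

VSet : Set₁
VSet = Var → Set

VRel : Set₁
VRel = Var → Var → Set

_≐_ : VSet → VSet → Set
X ≐ Y = ∀ x → (X x → Y x) × (Y x → X x)

_⊆ᴿ_ : VRel → VRel → Set
R ⊆ᴿ S = ∀ u v → R u v → S u v

_≐ᴿ_ : VRel → VRel → Set
R ≐ᴿ S = (R ⊆ᴿ S) × (S ⊆ᴿ R)

Finite : VSet → Set
Finite X = Σ (List Var) λ xs → ∀ x → (X x → x ∈ xs) × (x ∈ xs → X x)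

NonEmpty : VSet → Set
NonEmpty X = ∃ λ x → X x

IsSingleton : VSet → Var → Set
IsSingleton X x = ∀ y → (X y → y ≡ x) × (y ≡ x → X y)

AtLeastTwo : VSet → Set
AtLeastTwo X = Σ Var λ x → Σ Var λ y → x ≢ y × X x × X y

IsRelOn : VRel → VSet → Set
IsRelOn R X = ∀ u v → R u v → X u × X v

record IsGraph (G : VRel) (X : VSet) : Set where
  field
    onX      : IsRelOn G X
    symm     : ∀ u v → G u v → G v u
    irrefl   : ∀ u → ¬ G u u
    finite   : Finite X
    nonempty : NonEmpty X

data Reach (R : VRel) : Var → Var → Set where
  here : ∀ {x} → Reach R x x
  step : ∀ {x z y} → (R x z ⊎ R z x) → Reach R z y → Reach R x y

Connected : VRel → VSet → Set
Connected R X = ∀ x y → X x → X y → x ≢ y → Reach R x y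

_−ᴿ_ : VRel → Var → VRel
(R −ᴿ y) u v = R u v × u ≢ y × v ≢ y

_−ˢ_ : VSet → Var → VSet
(X −ˢ y) u = X u × u ≢ y

data Term : Set where
  var  : Var → Term
  _⊕_  : Term → Term → Term
  _⊙_  : Term → Term → Term

infixl 6 _⊕_
infixl 7 _⊙_

-- least congruence making ⊕ associative and commutative and ⊙ associative;
-- the class [t] is t modulo ≈
data _≈_ : Term → Term → Set where
  ≈-refl  : ∀ {t} → t ≈ t
  ≈-sym   : ∀ {t s} → t ≈ s → s ≈ t
  ≈-trans : ∀ {t s r} → t ≈ s → s ≈ r → t ≈ r
  ⊕-cong  : ∀ {t t' s s'} → t ≈ t' → s ≈ s' → (t ⊕ s) ≈ (t' ⊕ s')
  ⊙-cong  : ∀ {t t' s s'} → t ≈ t' → s ≈ s' → (t ⊙ s) ≈ (t' ⊙ s')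
  ⊕-assoc : ∀ {t s r} → ((t ⊕ s) ⊕ r) ≈ (t ⊕ (s ⊕ r))
  ⊕-comm  : ∀ {t s} → (t ⊕ s) ≈ (s ⊕ t)
  ⊙-assoc : ∀ {t s r} → ((t ⊙ s) ⊙ r) ≈ (t ⊙ (s ⊙ r))

-- variables of a term (the carrier of K[t])
vars : Term → VSet
vars (var x) y = y ≡ x
vars (t ⊕ s) y = vars t y ⊎ vars s y
vars (t ⊙ s) y = vars t y ⊎ vars s y

-- the relation of K[t]:  K[x] = ⟨∅,{x}⟩, K[t+s] = K[t]+K[s], K[t·s] = K[t]·K[s]
Kʳ : Term → VRel
Kʳ (var x) u v = ⊥
Kʳ (t ⊕ s) u v = Kʳ t u v ⊎ Kʳ s u v
Kʳ (t ⊙ s) u v = Kʳ t u v ⊎ Kʳ s u v ⊎ (vars t u × vars s v)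

record IsLinearOrder (R : VRel) (X : VSet) : Set where
  field
    onX    : IsRelOn R X
    irrefl : ∀ u → ¬ R u u
    trans  : ∀ u v w → R u v → R v w → R u w
    total  : ∀ u v → X u → X v → u ≢ v → R u v ⊎ R v u

-- membership in the set Λ with L⟨R,X⟩ = [Λ,X]
InL : VRel → VSet → VRel → Set
InL R X R' = (R ⊆ᴿ R') × IsLinearOrder R' X

-- Generating representatives of the classes in T⟨G,X⟩
data Gen : VRel → VSet → Term → Set₁ where
  gen-single : ∀ {G X} x → IsSingleton X x → Gen G X (var x)
  gen-conn   : ∀ {G X t} x → AtLeastTwo X → Connected G X → X x →
               Gen (G −ᴿ x) (X −ˢ x) t → Gen G X (var x ⊙ t)
  gen-disc   : ∀ {G X t₁ t₂} (G₁ G₂ : VRel) (X₁ X₂ : VSet) →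
               AtLeastTwo X → ¬ Connected G X →
               IsRelOn G₁ X₁ → IsRelOn G₂ X₂ →
               (∀ u → X₁ u → X₂ u → ⊥) →
               NonEmpty X₁ → NonEmpty X₂ →
               X ≐ (λ u → X₁ u ⊎ X₂ u) →
               G ≐ᴿ (λ u v → G₁ u v ⊎ G₂ u v) →
               Gen G₁ X₁ t₁ → Gen G₂ X₂ t₂ → Gen G X (t₁ ⊕ t₂)

InT : VRel → VSet → Term → Set₁
InT G X t = Σ Term λ t₀ → t ≈ t₀ × Gen G X t₀

module Submission where

-- We prove more generally that two terms generated from the same graph
-- ⟨G,X⟩ are ≈-equal whenever K[t] and K[t'] lie in a common asymmetric
-- relation R (lemma unique), by induction on the first generation tree:
--  * connected case x·t versus y·t': if x ≠ y then x R y and y R x, since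
--    every vertex occurs in a generated term; so x = y and we recurse on G−x;
--  * disconnected case t₁+t₂ versus t': the carrier X₁ of t₁ is closed under
--    the edges of G, and every generated term splits along such a closed set
--    into a part generated on X₁ and a part generated on its complement
--    (lemma split); we compare these parts with t₁ and t₂.
-- Splitting is done with possibly absent parts, i.e. in the commutative
-- monoid obtained from terms by adjoining an empty term.  The theorem follows
-- since K is invariant under ≈ and a linear order is asymmetric.

open import Defs
open import Data.Product using (Σ; _×_; _,_; proj₁; proj₂)
open import Data.Sum using (_⊎_; inj₁; inj₂; swap; assocʳ; assocˡ) renaming (map to ⊎-map)
open import Data.Empty using (⊥; ⊥-elim)
open import Data.Nat using (_≟_)
open import Data.Sum.Function.Propositional using (_⊎-⇔_)
open import Data.Product.Function.NonDependent.Propositional using (_×-⇔_)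
open import Function using (_∘_; _⇔_; mk⇔; Equivalence)
import Function.Properties.Equivalence as ⇔
open import Relation.Nullary using (¬_; Dec; yes; no)
open import Relation.Binary.PropositionalEquality using (_≡_; refl; sym)
open import Relation.Binary.Definitions using (Asymmetric)
open import Relation.Nullary.Construct.Add.Point using (Pointed; ∙; [_])
open import Relation.Binary.Construct.Add.Point.Equality _≈_
  using (_≈∙_; ∙≈∙; [_])
open import Algebra.Bundles using (CommutativeMonoid)
open import Level using (0ℓ)
import Algebra.Construct.Add.Identity as AddIdentity
import Algebra.Properties.CommutativeSemigroup as CommSemigroupProperties

-- vars and K are invariant under ≈, so they are well defined on classes [t].
vars-resp : ∀ {t s} → t ≈ s → ∀ u → vars t u ⇔ vars s u
vars-resp ≈-refl        u = ⇔.refl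
vars-resp (≈-sym e)     u = ⇔.sym (vars-resp e u)
vars-resp (≈-trans e f) u = ⇔.trans (vars-resp e u) (vars-resp f u)
vars-resp (⊕-cong e f)  u = vars-resp e u ⊎-⇔ vars-resp f u
vars-resp (⊙-cong e f)  u = vars-resp e u ⊎-⇔ vars-resp f u
vars-resp ⊕-assoc       u = mk⇔ assocʳ assocˡ
vars-resp ⊕-comm        u = mk⇔ swap swap
vars-resp ⊙-assoc       u = mk⇔ assocʳ assocˡ

K-resp : ∀ {t s} → t ≈ s → ∀ u v → Kʳ t u v ⇔ Kʳ s u v
K-resp ≈-refl        u v = ⇔.refl
K-resp (≈-sym e)     u v = ⇔.sym (K-resp e u v)
K-resp (≈-trans e f) u v = ⇔.trans (K-resp e u v) (K-resp f u v)
K-resp (⊕-cong e f)  u v = K-resp e u v ⊎-⇔ K-resp f u v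
K-resp (⊙-cong e f)  u v =
  K-resp e u v ⊎-⇔ K-resp f u v ⊎-⇔ (vars-resp e u ×-⇔ vars-resp f v)
K-resp ⊕-assoc       u v = mk⇔ assocʳ assocˡ
K-resp ⊕-comm        u v = mk⇔ swap swap
K-resp ⊙-assoc       u v = mk⇔
  (λ { (inj₁ (inj₁ k))                 → inj₁ k
     ; (inj₁ (inj₂ (inj₁ k)))          → inj₂ (inj₁ (inj₁ k))
     ; (inj₁ (inj₂ (inj₂ (a , b))))    → inj₂ (inj₂ (a , inj₁ b))
     ; (inj₂ (inj₁ k))                 → inj₂ (inj₁ (inj₂ (inj₁ k)))
     ; (inj₂ (inj₂ (inj₁ a , c)))      → inj₂ (inj₂ (a , inj₂ c))
     ; (inj₂ (inj₂ (inj₂ b , c)))      → inj₂ (inj₁ (inj₂ (inj₂ (b , c)))) })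
  (λ { (inj₁ k)                        → inj₁ (inj₁ k)
     ; (inj₂ (inj₁ (inj₁ k)))          → inj₁ (inj₂ (inj₁ k))
     ; (inj₂ (inj₁ (inj₂ (inj₁ k))))   → inj₂ (inj₁ k)
     ; (inj₂ (inj₁ (inj₂ (inj₂ (b , c))))) → inj₂ (inj₂ (inj₂ b , c))
     ; (inj₂ (inj₂ (a , inj₁ b)))      → inj₁ (inj₂ (inj₂ (a , b)))
     ; (inj₂ (inj₂ (a , inj₂ c)))      → inj₂ (inj₂ (inj₁ a , c)) })

-- Terms with a formal empty term adjoined form a commutative monoid under ⊕;
-- this lets a term be cut into two possibly empty parts.
_⊞_ : Pointed Term → Pointed Term → Pointed Term
_⊞_ = AddIdentity.liftOp _⊕_

pointed-commutativeMonoid : CommutativeMonoid 0ℓ 0ℓ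
pointed-commutativeMonoid = record
  { isCommutativeMonoid = record
    { isMonoid = AddIdentity.isMonoid record
      { isMagma = record
        { isEquivalence = record { refl = ≈-refl ; sym = ≈-sym ; trans = ≈-trans }
        ; ∙-cong = ⊕-cong }
      ; assoc = λ _ _ _ → ⊕-assoc }
    ; comm = comm } }
  where
  comm : ∀ a b → (a ⊞ b) ≈∙ (b ⊞ a)
  comm [ t ] [ s ] = [ ⊕-comm ]
  comm [ t ] ∙     = [ ≈-refl ]
  comm ∙     [ s ] = [ ≈-refl ]
  comm ∙     ∙     = ∙≈∙

open CommutativeMonoid pointed-commutativeMonoid
  using () renaming (trans to ≈∙-trans; ∙-cong to ⊞-cong)
open CommSemigroupProperties (CommutativeMonoid.commutativeSemigroup pointed-commutativeMonoid)
  using (interchange)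

_∩ˢ_ : VSet → VSet → VSet
(X ∩ˢ P) u = X u × P u

_∩ᴿ_ : VRel → VSet → VRel
(G ∩ᴿ P) u v = G u v × P u × P v

Not : VSet → VSet
Not A u = ¬ A u

≐-sym : ∀ {X Y} → X ≐ Y → Y ≐ X
≐-sym e u = proj₂ (e u) , proj₁ (e u)

≐-trans : ∀ {X Y Z} → X ≐ Y → Y ≐ Z → X ≐ Z
≐-trans e f u = proj₁ (f u) ∘ proj₁ (e u) , proj₂ (e u) ∘ proj₂ (f u)

≐ᴿ-sym : ∀ {G H} → G ≐ᴿ H → H ≐ᴿ G
≐ᴿ-sym (to , from) = from , to

≐ᴿ-trans : ∀ {G H I} → G ≐ᴿ H → H ≐ᴿ I → G ≐ᴿ I
≐ᴿ-trans (to₁ , from₁) (to₂ , from₂) =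
  (λ u v → to₂ u v ∘ to₁ u v) , (λ u v → from₁ u v ∘ from₂ u v)

restrict-whole : ∀ {G X P} → IsRelOn G X → (∀ u → X u → P u) →
                 (X ≐ (X ∩ˢ P)) × (G ≐ᴿ (G ∩ᴿ P))
restrict-whole on all =
  (λ u → (λ Xu → Xu , all u Xu) , proj₁) ,
  (λ u v g → g , all u (proj₁ (on u v g)) , all v (proj₂ (on u v g))) , (λ u v → proj₁)

restrict-on : ∀ {G X P} → IsRelOn G X → IsRelOn (G ∩ᴿ P) (X ∩ˢ P)
restrict-on on u v (g , Pu , Pv) = (proj₁ (on u v g) , Pu) , (proj₂ (on u v g) , Pv)

remove-on : ∀ {G X} x → IsRelOn G X → IsRelOn (G −ᴿ x) (X −ˢ x)
remove-on x on u v (g , u≢x , v≢x) = (proj₁ (on u v g) , u≢x) , (proj₂ (on u v g) , v≢x)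

Closed : VRel → VSet → Set
Closed G A = ∀ p q → G p q → (A p → A q) × (A q → A p)

closed-mono : ∀ {G H A} → H ⊆ᴿ G → Closed G A → Closed H A
closed-mono H⊆G cl p q h = cl p q (H⊆G p q h)

reach-closed : ∀ {G A u v} → Closed G A → Reach G u v → A u → A v
reach-closed cl here                      Au = Au
reach-closed cl (step {x} {z} (inj₁ g) r) Au = reach-closed cl r (proj₁ (cl x z g) Au)
reach-closed cl (step {x} {z} (inj₂ g) r) Au = reach-closed cl r (proj₂ (cl z x g) Au)

connected-uniform : ∀ {G X A x u} → Connected G X → Closed G A → X x → X u → A x → A u
connected-uniform {x = x} {u} c cl Xx Xu Ax with x ≟ u
... | yes refl = Ax
... | no x≢u   = reach-closed cl (c x u Xx Xu x≢u) Ax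

reach-mono : ∀ {G H u v} → G ⊆ᴿ H → Reach G u v → Reach H u v
reach-mono G⊆H here                      = here
reach-mono G⊆H (step {x} {z} (inj₁ g) r) = step (inj₁ (G⊆H x z g)) (reach-mono G⊆H r)
reach-mono G⊆H (step {x} {z} (inj₂ g) r) = step (inj₂ (G⊆H z x g)) (reach-mono G⊆H r)

connected-resp : ∀ {G H X Y} → X ≐ Y → G ⊆ᴿ H → Connected G X → Connected H Y
connected-resp eX G⊆H c x y Yx Yy x≢y =
  reach-mono G⊆H (c x y (proj₂ (eX x) Yx) (proj₂ (eX y) Yy) x≢y)

singleton-connected : ∀ {G X x} → IsSingleton X x → Connected G X
singleton-connected sx u v Xu Xv u≢v with proj₁ (sx u) Xu | proj₁ (sx v) Xv
... | refl | refl = ⊥-elim (u≢v refl)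

singleton-not-two : ∀ {X x} → IsSingleton X x → ¬ AtLeastTwo X
singleton-not-two sx (u , v , u≢v , Xu , Xv) with proj₁ (sx u) Xu | proj₁ (sx v) Xv
... | refl | refl = u≢v refl

two-resp : ∀ {X Y} → X ≐ Y → AtLeastTwo X → AtLeastTwo Y
two-resp eX (u , v , u≢v , Xu , Xv) = u , v , u≢v , proj₁ (eX u) Xu , proj₁ (eX v) Xv

gen-resp : ∀ {G H X Y t} → X ≐ Y → G ≐ᴿ H → Gen G X t → Gen H Y t
gen-resp eX eG (gen-single x sx) =
  gen-single x λ y → proj₁ (sx y) ∘ proj₂ (eX y) , proj₁ (eX y) ∘ proj₂ (sx y)
gen-resp eX eG (gen-conn x two c Xx d) =
  gen-conn x (two-resp eX two) (connected-resp eX (proj₁ eG) c) (proj₁ (eX x) Xx)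
    (gen-resp (λ u → (λ { (Xu , u≢x) → proj₁ (eX u) Xu , u≢x }) ,
                     (λ { (Yu , u≢x) → proj₂ (eX u) Yu , u≢x }))
              ((λ { u v (g , ne) → proj₁ eG u v g , ne }) ,
               (λ { u v (h , ne) → proj₂ eG u v h , ne }))
              d)
gen-resp eX eG (gen-disc G₁ G₂ X₁ X₂ two nc on₁ on₂ dj ne₁ ne₂ eX₁₂ eG₁₂ d₁ d₂) =
  gen-disc G₁ G₂ X₁ X₂ (two-resp eX two) (nc ∘ connected-resp (≐-sym eX) (proj₂ eG))
    on₁ on₂ dj ne₁ ne₂ (≐-trans (≐-sym eX) eX₁₂) (≐ᴿ-trans (≐ᴿ-sym eG) eG₁₂) d₁ d₂

gen-nonempty : ∀ {G X t} → Gen G X t → NonEmpty X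
gen-nonempty (gen-single x sx)        = x , proj₂ (sx x) refl
gen-nonempty (gen-conn x _ _ Xx _)    = x , Xx
gen-nonempty (gen-disc _ _ _ _ _ _ _ _ _ (u , X₁u) _ eX _ _ _) = u , proj₂ (eX u) (inj₁ X₁u)

gen-covers : ∀ {G X t} → Gen G X t → ∀ u → X u → vars t u
gen-covers (gen-single x sx) u Xu = proj₁ (sx u) Xu
gen-covers (gen-conn x _ _ _ d) u Xu with u ≟ x
... | yes u≡x = inj₁ u≡x
... | no u≢x  = inj₂ (gen-covers d u (Xu , u≢x))
gen-covers (gen-disc _ _ _ _ _ _ _ _ _ _ _ eX _ d₁ d₂) u Xu =
  ⊎-map (gen-covers d₁ u) (gen-covers d₂ u) (proj₁ (eX u) Xu)

record IsSum (G : VRel) (X : VSet) (G₁ : VRel) (X₁ : VSet) (G₂ : VRel) (X₂ : VSet) : Set where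
  constructor mkSum
  field
    on₁      : IsRelOn G₁ X₁
    on₂      : IsRelOn G₂ X₂
    disjoint : ∀ u → X₁ u → X₂ u → ⊥
    carrier  : X ≐ (λ u → X₁ u ⊎ X₂ u)
    edges    : G ≐ᴿ (λ u v → G₁ u v ⊎ G₂ u v)
open IsSum

sum-swap : ∀ {G X G₁ X₁ G₂ X₂} → IsSum G X G₁ X₁ G₂ X₂ → IsSum G X G₂ X₂ G₁ X₁
sum-swap (mkSum on₁ on₂ dj eX eG) =
  mkSum on₂ on₁ (λ u X₂u X₁u → dj u X₁u X₂u)
    (λ u → swap ∘ proj₁ (eX u) , proj₂ (eX u) ∘ swap)
    ((λ u v → swap ∘ proj₁ eG u v) , (λ u v → proj₂ eG u v ∘ swap))

sum-restrict : ∀ {G X G₁ X₁ G₂ X₂ P} → IsSum G X G₁ X₁ G₂ X₂ →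
               IsSum (G ∩ᴿ P) (X ∩ˢ P) (G₁ ∩ᴿ P) (X₁ ∩ˢ P) (G₂ ∩ᴿ P) (X₂ ∩ˢ P)
sum-restrict (mkSum on₁ on₂ dj eX eG) =
  mkSum (restrict-on on₁) (restrict-on on₂) (λ u a b → dj u (proj₁ a) (proj₁ b))
    (λ u → (λ { (Xu , Pu) → ⊎-map (_, Pu) (_, Pu) (proj₁ (eX u) Xu) }) ,
           (λ { (inj₁ (X₁u , Pu)) → proj₂ (eX u) (inj₁ X₁u) , Pu
              ; (inj₂ (X₂u , Pu)) → proj₂ (eX u) (inj₂ X₂u) , Pu }))
    ((λ { u v (g , P) → ⊎-map (_, P) (_, P) (proj₁ eG u v g) }) ,
     (λ { u v (inj₁ (g , P)) → proj₂ eG u v (inj₁ g) , P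
        ; u v (inj₂ (g , P)) → proj₂ eG u v (inj₂ g) , P }))

sum-empty-right : ∀ {G X G₁ X₁ G₂ X₂} → IsSum G X G₁ X₁ G₂ X₂ → (∀ u → ¬ X₂ u) →
                  (X ≐ X₁) × (G ≐ᴿ G₁)
sum-empty-right {G₁ = G₁} {X₁} {G₂} {X₂} (mkSum on₁ on₂ dj eX eG) empty =
  (λ u → left u ∘ proj₁ (eX u) , proj₂ (eX u) ∘ inj₁) ,
  (λ u v → leftᴿ u v ∘ proj₁ eG u v) , (λ u v → proj₂ eG u v ∘ inj₁)
  where
  left : ∀ u → X₁ u ⊎ X₂ u → X₁ u
  left u (inj₁ X₁u) = X₁u
  left u (inj₂ X₂u) = ⊥-elim (empty u X₂u)
  leftᴿ : ∀ u v → G₁ u v ⊎ G₂ u v → G₁ u v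
  leftᴿ u v (inj₁ g) = g
  leftᴿ u v (inj₂ g) = ⊥-elim (empty u (proj₁ (on₂ u v g)))

sum-component : ∀ {G X G₁ X₁ G₂ X₂ P} → IsSum G X G₁ X₁ G₂ X₂ →
                (∀ u → X₁ u → P u) → (∀ u → X₂ u → ¬ P u) →
                (X₁ ≐ (X ∩ˢ P)) × (G₁ ≐ᴿ (G ∩ᴿ P))
sum-component s select reject
  with restrict-whole (on₁ s) select
     | sum-empty-right (sum-restrict s) (λ u → λ { (X₂u , Pu) → reject u X₂u Pu })
... | eX₁ , eG₁ | eX , eG = ≐-trans eX₁ (≐-sym eX) , ≐ᴿ-trans eG₁ (≐ᴿ-sym eG)

left-summand : ∀ {G X G₁ X₁ G₂ X₂ c} → IsSum G X G₁ X₁ G₂ X₂ →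
               Gen (G ∩ᴿ X₁) (X ∩ˢ X₁) c → Gen G₁ X₁ c
left-summand s with sum-component s (λ _ X₁u → X₁u) (λ u X₂u X₁u → disjoint s u X₁u X₂u)
... | eX , eG = gen-resp (≐-sym eX) (≐ᴿ-sym eG)

right-summand : ∀ {G X G₁ X₁ G₂ X₂ c} → IsSum G X G₁ X₁ G₂ X₂ →
                Gen (G ∩ᴿ Not X₁) (X ∩ˢ Not X₁) c → Gen G₂ X₂ c
right-summand s
  with sum-component (sum-swap s) (λ u X₂u X₁u → disjoint s u X₁u X₂u) (λ u X₁u ¬X₁u → ¬X₁u X₁u)
... | eX , eG = gen-resp (≐-sym eX) (≐ᴿ-sym eG)

sum-closed : ∀ {G X G₁ X₁ G₂ X₂} → IsSum G X G₁ X₁ G₂ X₂ → Closed G X₁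
sum-closed (mkSum on₁ on₂ dj eX eG) p q g with proj₁ eG p q g
... | inj₁ g₁ = (λ _ → proj₂ (on₁ p q g₁)) , (λ _ → proj₁ (on₁ p q g₁))
... | inj₂ g₂ = (λ X₁p → ⊥-elim (dj p X₁p (proj₁ (on₂ p q g₂)))) ,
                (λ X₁q → ⊥-elim (dj q X₁q (proj₂ (on₂ p q g₂))))

sum-decide : ∀ {G X G₁ X₁ G₂ X₂} → IsSum G X G₁ X₁ G₂ X₂ → ∀ u → X u → Dec (X₁ u)
sum-decide (mkSum _ _ dj eX _) u Xu with proj₁ (eX u) Xu
... | inj₁ X₁u = yes X₁u
... | inj₂ X₂u = no λ X₁u → dj u X₁u X₂u

sum-disconnected : ∀ {G X G₁ X₁ G₂ X₂} → IsSum G X G₁ X₁ G₂ X₂ →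
                   NonEmpty X₁ → NonEmpty X₂ → AtLeastTwo X × ¬ Connected G X
sum-disconnected {X = X} s@(mkSum _ _ dj eX _) (u₁ , X₁u₁) (u₂ , X₂u₂) =
  (u₁ , u₂ , u₁≢u₂ , Xu₁ , Xu₂) ,
  λ c → dj u₂ (reach-closed (sum-closed s) (c u₁ u₂ Xu₁ Xu₂ u₁≢u₂) X₁u₁) X₂u₂
  where
  Xu₁ : X u₁
  Xu₁ = proj₂ (eX u₁) (inj₁ X₁u₁)
  Xu₂ : X u₂
  Xu₂ = proj₂ (eX u₂) (inj₂ X₂u₂)
  u₁≢u₂ : u₁ ≡ u₂ → ⊥
  u₁≢u₂ refl = dj u₁ X₁u₁ X₂u₂

gen-sum : ∀ {G X G₁ X₁ G₂ X₂ t₁ t₂} → IsSum G X G₁ X₁ G₂ X₂ →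
          Gen G₁ X₁ t₁ → Gen G₂ X₂ t₂ → Gen G X (t₁ ⊕ t₂)
gen-sum {G₁ = G₁} {X₁} {G₂} {X₂} s@(mkSum on₁ on₂ dj eX eG) d₁ d₂
  with sum-disconnected s (gen-nonempty d₁) (gen-nonempty d₂)
... | two , nc =
  gen-disc G₁ G₂ X₁ X₂ two nc on₁ on₂ dj (gen-nonempty d₁) (gen-nonempty d₂) eX eG d₁ d₂

restrict-left : ∀ {G X G₁ X₁ G₂ X₂ P c} → IsSum G X G₁ X₁ G₂ X₂ → (∀ u → X₂ u → ¬ P u) →
                Gen (G₁ ∩ᴿ P) (X₁ ∩ˢ P) c → Gen (G ∩ᴿ P) (X ∩ˢ P) c
restrict-left s avoid
  with sum-empty-right (sum-restrict s) (λ u → λ { (X₂u , Pu) → avoid u X₂u Pu })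
... | eX , eG = gen-resp (≐-sym eX) (≐ᴿ-sym eG)

data Part (G : VRel) (X : VSet) (P : VSet) : Pointed Term → Set₁ where
  absent  : (∀ u → X u → ¬ P u) → Part G X P ∙
  present : ∀ {c} → Gen (G ∩ᴿ P) (X ∩ˢ P) c → Part G X P [ c ]

merge : ∀ {G X G₁ X₁ G₂ X₂ P a b} → IsSum G X G₁ X₁ G₂ X₂ →
        Part G₁ X₁ P a → Part G₂ X₂ P b → Part G X P (a ⊞ b)
merge {X₁ = X₁} {X₂ = X₂} {P} s (absent n₁) (absent n₂) =
  absent λ u Xu → neither u (proj₁ (carrier s u) Xu)
  where
  neither : ∀ u → X₁ u ⊎ X₂ u → ¬ P u
  neither u (inj₁ X₁u) = n₁ u X₁u
  neither u (inj₂ X₂u) = n₂ u X₂u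
merge s (present d₁) (absent n₂)  = present (restrict-left s n₂ d₁)
merge s (absent n₁)  (present d₂) = present (restrict-left (sum-swap s) n₁ d₂)
merge s (present d₁) (present d₂) = present (gen-sum (sum-restrict s) d₁ d₂)

data Split (G : VRel) (X : VSet) (A : VSet) (t : Term) : Set₁ where
  splitting : ∀ {a b} → Part G X A a → Part G X (Not A) b → [ t ] ≈∙ (a ⊞ b) → Split G X A t

split-inside : ∀ {G X A t} → Gen G X t → IsRelOn G X → (∀ u → X u → A u) → Split G X A t
split-inside d on inside with restrict-whole on inside
... | eX , eG =
  splitting (present (gen-resp eX eG d)) (absent λ u Xu ¬Au → ¬Au (inside u Xu)) [ ≈-refl ]

split-outside : ∀ {G X A t} → Gen G X t → IsRelOn G X → (∀ u → X u → ¬ A u) → Split G X A t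
split-outside d on outside with restrict-whole on outside
... | eX , eG = splitting (absent outside) (present (gen-resp eX eG d)) [ ≈-refl ]

-- A connected graph lies entirely on one side of a closed set.
split-connected : ∀ {G X A t x} → Gen G X t → IsRelOn G X → Connected G X → Closed G A →
                  X x → Dec (A x) → Split G X A t
split-connected d on c cl Xx (yes Ax) =
  split-inside d on λ u Xu → connected-uniform c cl Xx Xu Ax
split-connected d on c cl Xx (no ¬Ax) =
  split-outside d on λ u Xu Au → ¬Ax (connected-uniform c cl Xu Xx Au)

split-sum : ∀ {G X G₁ X₁ G₂ X₂ A t₁ t₂} → IsSum G X G₁ X₁ G₂ X₂ →
            Split G₁ X₁ A t₁ → Split G₂ X₂ A t₂ → Split G X A (t₁ ⊕ t₂)
split-sum s (splitting a₁ b₁ e₁) (splitting a₂ b₂ e₂) =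
  splitting (merge s a₁ a₂) (merge s b₁ b₂) (≈∙-trans (⊞-cong e₁ e₂) (interchange _ _ _ _))

split : ∀ {G X A t} → Gen G X t → IsRelOn G X → Closed G A → (∀ u → X u → Dec (A u)) →
        Split G X A t
split d@(gen-single x sx) on cl dec =
  split-connected d on (singleton-connected sx) cl Xx (dec x Xx)
  where Xx = proj₂ (sx x) refl
split d@(gen-conn x _ c Xx _) on cl dec = split-connected d on c cl Xx (dec x Xx)
split (gen-disc G₁ G₂ X₁ X₂ _ _ on₁ on₂ dj _ _ eX eG d₁ d₂) on cl dec =
  split-sum s (split d₁ on₁ (closed-mono (λ u v → proj₂ eG u v ∘ inj₁) cl)
                      (λ u → dec u ∘ proj₂ (eX u) ∘ inj₁))
              (split d₂ on₂ (closed-mono (λ u v → proj₂ eG u v ∘ inj₂) cl)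
                      (λ u → dec u ∘ proj₂ (eX u) ∘ inj₂))
  where s = mkSum on₁ on₂ dj eX eG

unique : ∀ {G X t t'} (R : VRel) → Asymmetric R → IsRelOn G X →
         Gen G X t → Gen G X t' → Kʳ t ⊆ᴿ R → Kʳ t' ⊆ᴿ R → t ≈ t'
unique R asym on (gen-single x sx) (gen-single y sy) K K'
  with proj₁ (sy x) (proj₂ (sx x) refl)
... | refl = ≈-refl
unique R asym on (gen-single x sx) (gen-conn _ two _ _ _) K K' =
  ⊥-elim (singleton-not-two sx two)
unique R asym on (gen-single x sx) (gen-disc _ _ _ _ two _ _ _ _ _ _ _ _ _ _) K K' =
  ⊥-elim (singleton-not-two sx two)
unique R asym on (gen-conn _ two _ _ _) (gen-single y sy) K K' =
  ⊥-elim (singleton-not-two sy two)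
unique R asym on (gen-disc _ _ _ _ two _ _ _ _ _ _ _ _ _ _) (gen-single y sy) K K' =
  ⊥-elim (singleton-not-two sy two)
unique R asym on (gen-conn _ _ c _ _) (gen-disc _ _ _ _ _ nc _ _ _ _ _ _ _ _ _) K K' =
  ⊥-elim (nc c)
unique R asym on (gen-disc _ _ _ _ _ nc _ _ _ _ _ _ _ _ _) (gen-conn _ _ c _ _) K K' =
  ⊥-elim (nc c)
-- x · t and y · t' with x ≢ y would force both x R y and y R x.
unique R asym on (gen-conn x _ _ Xx d) (gen-conn y _ _ Xy d') K K' with x ≟ y
... | yes refl =
  ⊙-cong ≈-refl (unique R asym (remove-on x on) d d'
                   (λ u v → K u v ∘ inj₂ ∘ inj₁) (λ u v → K' u v ∘ inj₂ ∘ inj₁))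
... | no x≢y = ⊥-elim (asym (K x y (inj₂ (inj₂ (refl , y∈t)))) (K' y x (inj₂ (inj₂ (refl , x∈t')))))
  where
  y∈t  = gen-covers d y (Xy , x≢y ∘ sym)
  x∈t' = gen-covers d' x (Xx , x≢y)
-- t₁ + t₂ against t': split t' along the component X₁ and compare the pieces.
unique {G} {X} {t' = t'} R asym on
       (gen-disc {t₁ = t₁} {t₂} G₁ G₂ X₁ X₂ _ _ on₁ on₂ dj (u₁ , X₁u₁) (u₂ , X₂u₂) eX eG d₁ d₂)
       d' K K' =
  compare (split d' on (sum-closed s) (sum-decide s))
  where
  s : IsSum G X G₁ X₁ G₂ X₂
  s = mkSum on₁ on₂ dj eX eG
  compare : Split G X X₁ t' → (t₁ ⊕ t₂) ≈ t'
  compare (splitting (absent none) _ _) = ⊥-elim (none u₁ (proj₂ (eX u₁) (inj₁ X₁u₁)) X₁u₁)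
  compare (splitting _ (absent none) _) =
    ⊥-elim (none u₂ (proj₂ (eX u₂) (inj₂ X₂u₂)) λ X₁u₂ → dj u₂ X₁u₂ X₂u₂)
  compare (splitting {[ c₁ ]} {[ c₂ ]} (present e₁) (present e₂) [ t'≈c ]) =
    ≈-trans (⊕-cong same₁ same₂) (≈-sym t'≈c)
    where
    Kc : Kʳ (c₁ ⊕ c₂) ⊆ᴿ R
    Kc u v = K' u v ∘ Equivalence.from (K-resp t'≈c u v)
    same₁ : t₁ ≈ c₁
    same₁ = unique R asym on₁ d₁ (left-summand s e₁) (λ u v → K u v ∘ inj₁) (λ u v → Kc u v ∘ inj₁)
    same₂ : t₂ ≈ c₂
    same₂ = unique R asym on₂ d₂ (right-summand s e₂) (λ u v → K u v ∘ inj₂) (λ u v → Kc u v ∘ inj₂)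

proposition5p7 : (G : VRel) (X : VSet) → IsGraph G X →
    (t t' : Term) → InT G X t → InT G X t' →
    Σ VRel (λ R' → InL (Kʳ t) (vars t) R' × InL (Kʳ t') (vars t') R') →
    t ≈ t'
proposition5p7 G X graph t t' (t₀ , t≈t₀ , d) (t₀' , t'≈t₀' , d') (R , (Kt⊆R , linear) , (Kt'⊆R , _)) =
  ≈-trans t≈t₀ (≈-trans (unique R asym (IsGraph.onX graph) d d' K₀ K₀') (≈-sym t'≈t₀'))
  where
  open IsLinearOrder linear using (irrefl; trans)
  asym : Asymmetric R
  asym {u} {v} Ruv Rvu = irrefl u (trans u v u Ruv Rvu)
  K₀ : Kʳ t₀ ⊆ᴿ R
  K₀ u v = Kt⊆R u v ∘ Equivalence.from (K-resp t≈t₀ u v)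
  K₀' : Kʳ t₀' ⊆ᴿ R
  K₀' u v = Kt'⊆R u v ∘ Equivalence.from (K-resp t'≈t₀' u v)
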